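{- Let $G$ and $H$ be connected graphs, at least one of them non-bipartite, with roots $R_G$ and $R_H$. Then $Res(G\times H,\;R_G\times R_H)$ is the subgraph of $G\times H$ induced on all vertices $(u,v)\in V(G\times H)$ for which \[d(R_G\times R_H,(u,v))=\max_{(g,h)\in V(G\times H)}\;\min_{r_G\in V(R_G),\,r_H\in V(R_H)}\min\{m\in\mathbb{N} : G\text{ has an } r_G\text{–}g \text{ walk of length } m \text{ and } H \text{ has an } r_H\text{–}h\text{ walk of length } m\}.\]
   Context: A root of a connected finite graph $G$ is an induced subgraph $R_G=\langle V_0\rangle$ on a nonempty vertex set $V_0$; with $V_i$ the set of vertices at distance exactly $i$ from $V_0$ and $r$ the largest $i$ with $V_i\ne\emptyset$, the distance-residual graph is $Res(G,R_G)=\langle V_r\rangle$. $d(R,x)=\min_{y\in V(R)}d(y,x)$. $G\times H$ is the direct (tensor) product: vertex set $V(G)\times V(H)$, with $(u,x)\sim(v,y)$ iff $uv\in E(G)$ and $xy\in E(H)$; $R_G\times R_H$ is the subgraph induced on $V(R_G)\times V(R_H)$. -}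

module Defs where

open import Data.Nat using (ℕ; zero; suc; _≤_)
open import Data.Fin using (Fin)
open import Data.Bool using (Bool; true; false)
open import Data.Product using (Σ; ∃; ∃-syntax; _×_; _,_)
open import Relation.Binary.PropositionalEquality using (_≡_; _≢_)
open import Relation.Nullary using (¬_)

record Graph (n : ℕ) : Set where
  field
    adj    : Fin n → Fin n → Bool
    symm   : ∀ x y → adj x y ≡ adj y x
    irrefl : ∀ x → adj x x ≡ false
open Graph public

module _ {V : Set} (Adj : V → V → Set) where

  data Walk : V → V → ℕ → Set where
    [] : ∀ {x} → Walk x x zero
    _∷_ : ∀ {x y z m} → Adj x y → Walk y z m → Walk x z (suc m)

  Connected' : Set
  Connected' = ∀ x y → ∃[ m ] Walk x y m

  DistR : (V → Set) → V → ℕ → Set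
  DistR R x k =
    (∃[ r ] (R r × Walk r x k)) ×
    (∀ r j → R r → Walk r x j → k ≤ j)

  IsEcc : (V → Set) → ℕ → Set
  IsEcc R r = (∃[ x ] DistR R x r) × (∀ x k → DistR R x k → k ≤ r)

  -- vertex set V_r of the distance-residual graph Res(G, R) = ⟨V_r⟩
  InRes : (V → Set) → V → Set
  InRes R x = ∃[ r ] (IsEcc R r × DistR R x r)

Adj : ∀ {n} → Graph n → Fin n → Fin n → Set
Adj G x y = adj G x y ≡ true

Connected : ∀ {n} → Graph n → Set
Connected G = Connected' (Adj G)

Bipartite : ∀ {n} → Graph n → Set
Bipartite G = Σ (_ → Bool) λ c → ∀ x y → Adj G x y → c x ≢ c y

-- A root: nonempty vertex subset (the root is the subgraph induced on it)
record Root {n : ℕ} (G : Graph n) : Set where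
  field
    mem      : Fin n → Bool
    nonempty : ∃[ r ] (mem r ≡ true)
open Root public

InRoot : ∀ {n} {G : Graph n} → Root G → Fin n → Set
InRoot R x = mem R x ≡ true

ProdAdj : ∀ {n m} → Graph n → Graph m → (Fin n × Fin m) → (Fin n × Fin m) → Set
ProdAdj G H (u , x) (v , y) = Adj G u v × Adj H x y

ProdRoot : ∀ {n m} {G : Graph n} {H : Graph m} → Root G → Root H → (Fin n × Fin m) → Set
ProdRoot RG RH (u , x) = InRoot RG u × InRoot RH x

CommonWalk : ∀ {n m} (G : Graph n) (H : Graph m) → Fin n → Fin m → Fin n → Fin m → ℕ → Set
CommonWalk G H rG rH g h k = Walk (Adj G) rG g k × Walk (Adj H) rH h k

MinCommon : ∀ {n m} {G : Graph n} {H : Graph m} → Root G → Root H → Fin n → Fin m → ℕ → Set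
MinCommon {G = G} {H} RG RH g h k =
  (∃[ rG ] ∃[ rH ] (InRoot RG rG × InRoot RH rH × CommonWalk G H rG rH g h k)) ×
  (∀ rG rH j → InRoot RG rG → InRoot RH rH → CommonWalk G H rG rH g h j → k ≤ j)

MaxMinCommon : ∀ {n m} {G : Graph n} {H : Graph m} → Root G → Root H → ℕ → Set
MaxMinCommon RG RH M =
  (∃[ g ] ∃[ h ] MinCommon RG RH g h M) ×
  (∀ g h k → MinCommon RG RH g h k → k ≤ M)

{-# OPTIONS --safe #-}
module Submission where

-- A walk in G × H is exactly a pair of walks of equal length in G and in H, so
-- d(R_G × R_H, (g , h)) is the least common walk length from the roots, and the
-- eccentricity of R_G × R_H is the maximum of these over all vertices; the
-- residual graph is then read off as the vertices attaining that maximum.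
-- Connectivity and non-bipartiteness only guarantee that these distances exist
-- (G × H is then connected).

open import Defs
open import Data.Nat using (ℕ)
open import Data.Fin using (Fin)
open import Data.Product using (∃-syntax; _×_; _,_; map; map₁; map₂; uncurry)
open import Relation.Nullary using (¬_)
open import Function.Bundles using (_⇔_; mk⇔; module Equivalence)

module _ {n m} {G : Graph n} {H : Graph m} where

  unzipWalk : ∀ {a b u v k} →
              Walk (ProdAdj G H) (a , b) (u , v) k → CommonWalk G H a b u v k
  unzipWalk [] = [] , []
  unzipWalk (_∷_ {y = _ , _} (p , q) w) = map (p ∷_) (q ∷_) (unzipWalk w)

  zipWalk : ∀ {a b u v k} →
            Walk (Adj G) a u k → Walk (Adj H) b v k → Walk (ProdAdj G H) (a , b) (u , v) k
  zipWalk [] [] = []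
  zipWalk (p ∷ wG) (q ∷ wH) = (p , q) ∷ zipWalk wG wH

  module _ (RG : Root G) (RH : Root H) where

    ProdDistR⇔MinCommon : ∀ {g h k} →
                          DistR (ProdAdj G H) (ProdRoot RG RH) (g , h) k ⇔ MinCommon RG RH g h k
    ProdDistR⇔MinCommon = mk⇔ to from
      where
      to : ∀ {g h k} → DistR (ProdAdj G H) (ProdRoot RG RH) (g , h) k → MinCommon RG RH g h k
      to (((rG , rH) , (inG , inH) , w) , least) =
        (rG , rH , inG , inH , unzipWalk w) ,
        λ rG′ rH′ j inG′ inH′ cw → least (rG′ , rH′) j (inG′ , inH′) (uncurry zipWalk cw)

      from : ∀ {g h k} → MinCommon RG RH g h k → DistR (ProdAdj G H) (ProdRoot RG RH) (g , h) k
      from ((rG , rH , inG , inH , cw) , least) =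
        ((rG , rH) , (inG , inH) , uncurry zipWalk cw) ,
        λ { (rG′ , rH′) j (inG′ , inH′) w → least rG′ rH′ j inG′ inH′ (unzipWalk w) }

    ProdIsEcc⇔MaxMinCommon : ∀ {M} → IsEcc (ProdAdj G H) (ProdRoot RG RH) M ⇔ MaxMinCommon RG RH M
    ProdIsEcc⇔MaxMinCommon = mk⇔ to from
      where
      to : ∀ {M} → IsEcc (ProdAdj G H) (ProdRoot RG RH) M → MaxMinCommon RG RH M
      to (((g , h) , d) , largest) =
        (g , h , Equivalence.to ProdDistR⇔MinCommon d) ,
        λ g′ h′ k mc → largest (g′ , h′) k (Equivalence.from ProdDistR⇔MinCommon mc)

      from : ∀ {M} → MaxMinCommon RG RH M → IsEcc (ProdAdj G H) (ProdRoot RG RH) M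
      from ((g , h , mc) , largest) =
        ((g , h) , Equivalence.from ProdDistR⇔MinCommon mc) ,
        λ { (g′ , h′) k d → largest g′ h′ k (Equivalence.to ProdDistR⇔MinCommon d) }

theorem7 : ∀ {n m} (G : Graph n) (H : Graph m) →
           Connected G → Connected H →
           ¬ (Bipartite G × Bipartite H) →
           (RG : Root G) (RH : Root H) →
           ∀ (u : Fin n) (v : Fin m) →
           InRes (ProdAdj G H) (ProdRoot RG RH) (u , v)
             ⇔ (∃[ M ] (MaxMinCommon RG RH M × DistR (ProdAdj G H) (ProdRoot RG RH) (u , v) M))
theorem7 G H _ _ _ RG RH u v =
  mk⇔ (map₂ (map₁ (Equivalence.to (ProdIsEcc⇔MaxMinCommon RG RH))))
      (map₂ (map₁ (Equivalence.from (ProdIsEcc⇔MaxMinCommon RG RH))))
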